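{- Let $G=(V,E)$ be a finite simple undirected graph and $w\in V$. Let $(G,\mathcal{L})$ be a linear reassembling of $G$ anchored at $w$ and $(G,\varphi)$ a linear arrangement of $G$ anchored at $w$, such that $(G,\varphi)$ is induced by $(G,\mathcal{L})$ or $(G,\mathcal{L})$ is induced by $(G,\varphi)$. Then $(G,\mathcal{L})$ is $\beta$-optimal relative to anchor $w$ if and only if $(G,\varphi)$ is $\beta$-optimal relative to anchor $w$.
   Context: Let $n=|V|$. For $X\subseteq V$, $\deg_G(X)$ is the number of edges with exactly one endpoint in $X$. A linear binary tree over $V$ is a collection $\mathcal{L}=\{\{v_j\}\mid 1\le j\le n\}\cup\{\{v_1,\dots,v_k\}\mid 2\le k\le n\}$ for some enumeration $v_1,\dots,v_n$ of $V$ (determined by $\mathcal{L}$ up to swapping $v_1,v_2$); $(G,\mathcal{L})$ is a linear reassembling with $\beta(G,\mathcal{L})=\sum_{X\in\mathcal{L}}\deg_G(X)$. It is anchored at $w$ if its smallest non-singleton cluster is $\{w,w'\}$ for some $w'$ with $\deg_G(w)\le\deg_G(w')$. A linear arrangement is a bijection $\varphi:V\to\{1,\dots,n\}$ with $\beta(G,\varphi)=\sum_{i=1}^{n}\deg_G(\{v\mid\varphi(v)\le i\})$; it is anchored at $w$ if $\varphi(w)=1$ and $\varphi(w')=2$ for some $w'$ with $\deg_G(w)\le\deg_G(w')$. A linear reassembling (resp. arrangement) anchored at $w$ is $\beta$-optimal relative to anchor $w$ if its $\beta$ value is minimal among all linear reassemblings (resp. arrangements) of $G$ anchored at $w$. The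 linear arrangement induced by $(G,\mathcal{L})$ (enumeration $v_1,\dots,v_n$) is $\varphi$ with $\varphi(v_i)=i$ for $i\ge3$ and $\{\varphi(v_1),\varphi(v_2)\}=\{1,2\}$, the one of $v_1,v_2$ of smaller (ties: either) degree at position $1$. The linear reassembling induced by $(G,\varphi)$ is the one with enumeration $\varphi^{ -1}(1),\dots,\varphi^{ -1}(n)$. -}

module Defs where

open import Data.Nat using (ℕ; zero; suc; _+_; _≤_; _≤?_)
open import Data.Bool using (Bool; true; false; if_then_else_; _∧_; not)
open import Data.Fin using (Fin; toℕ; _≟_)
import Data.Fin
open import Data.Fin.Permutation using (Permutation′; _⟨$⟩ʳ_; _⟨$⟩ˡ_; flip)
open import Data.Product using (Σ; ∃; _×_; _,_)
open import Data.Sum using (_⊎_)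
open import Relation.Binary.PropositionalEquality using (_≡_)
open import Relation.Nullary.Decidable using (⌊_⌋)
open import Function.Bundles using (_⇔_)

record Graph (n : ℕ) : Set where
  field
    adj   : Fin n → Fin n → Bool
    sym   : ∀ u v → adj u v ≡ adj v u
    irrefl : ∀ v → adj v v ≡ false
open Graph public

∑ : ∀ {n} → (Fin n → ℕ) → ℕ
∑ {zero}  f = 0
∑ {suc n} f = f Data.Fin.zero + ∑ (λ i → f (Data.Fin.suc i))

VSet : ℕ → Set
VSet n = Fin n → Bool

-- deg_G(X): number of edges with exactly one endpoint in X
-- (each such edge counted once, as the ordered pair (inside, outside)).
degS : ∀ {n} → Graph n → VSet n → ℕ
degS G X = ∑ λ u → ∑ λ v → if X u ∧ not (X v) ∧ adj G u v then 1 else 0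

singleton : ∀ {n} → Fin n → VSet n
singleton w v = ⌊ v ≟ w ⌋

degV : ∀ {n} → Graph n → Fin n → ℕ
degV G v = degS G (singleton v)

_≐_ : ∀ {n} → VSet n → VSet n → Set
X ≐ Y = ∀ v → X v ≡ Y v

-- Enumerations v_1,…,v_n of V are permutations e with e ⟨$⟩ʳ i = v_{i+1}
-- (positions are 0-indexed).  The prefix {v_1,…,v_{k+1}}:
prefix : ∀ {n} → Permutation′ n → ℕ → VSet n
prefix e k v = ⌊ _≤?_ (toℕ (e ⟨$⟩ˡ v)) k ⌋

-- The linear binary tree L(e) determined by enumeration e, as a collection
-- of subsets: singletons {v_j} and prefixes {v_1..v_k} with 2 ≤ k ≤ n.
InLBT : ∀ {n} → Permutation′ n → VSet n → Set
InLBT {n} e X = (∃ λ j → X ≐ singleton (e ⟨$⟩ʳ j))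
          ⊎ (∃ λ (i : Fin n) → 1 ≤ toℕ i × X ≐ prefix e (toℕ i))

SameLBT : ∀ {n} → Permutation′ n → Permutation′ n → Set
SameLBT e e' = ∀ X → InLBT e X ⇔ InLBT e' X

-- β(G,L(e)) = Σ_j deg{v_j} + Σ_{k=2}^{n} deg{v_1..v_k}
-- (the clusters are pairwise distinct, so this is the sum over L).
βL : ∀ {n} → Graph n → Permutation′ n → ℕ
βL {n} G e = ∑ (λ j → degS G (singleton (e ⟨$⟩ʳ j)))
       + ∑ (λ (i : Fin n) → if ⌊ _≤?_ 1 (toℕ i) ⌋ then degS G (prefix e (toℕ i)) else 0)

-- linear arrangement φ : V → positions (0-indexed);
-- β(G,φ) = Σ_{i} deg{v | φ(v) ≤ i}
βA : ∀ {n} → Graph n → Permutation′ n → ℕ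
βA {n} G φ = ∑ λ (i : Fin n) → degS G (λ v → ⌊ _≤?_ (toℕ (φ ⟨$⟩ʳ v)) (toℕ i) ⌋)

-- L(e) anchored at w: smallest non-singleton cluster {v_1,v_2} = {w,w'}
-- with deg w ≤ deg w'.
AnchoredL : ∀ {n} → Graph n → Permutation′ n → Fin n → Set
AnchoredL {n} G e w = ∃ λ w' → degV G w ≤ degV G w' ×
  (∃ λ (i : Fin n) → ∃ λ (j : Fin n) → toℕ i ≡ 0 × toℕ j ≡ 1 ×
     ((e ⟨$⟩ʳ i ≡ w × e ⟨$⟩ʳ j ≡ w') ⊎ (e ⟨$⟩ʳ i ≡ w' × e ⟨$⟩ʳ j ≡ w)))

-- φ anchored at w: φ(w) = 1, φ(w') = 2 (0-indexed: 0,1), deg w ≤ deg w'.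
AnchoredA : ∀ {n} → Graph n → Permutation′ n → Fin n → Set
AnchoredA G φ w = ∃ λ w' → degV G w ≤ degV G w' ×
  toℕ (φ ⟨$⟩ʳ w) ≡ 0 × toℕ (φ ⟨$⟩ʳ w') ≡ 1

OptimalL : ∀ {n} → Graph n → Permutation′ n → Fin n → Set
OptimalL G e w = AnchoredL G e w × (∀ e' → AnchoredL G e' w → βL G e ≤ βL G e')

OptimalA : ∀ {n} → Graph n → Permutation′ n → Fin n → Set
OptimalA G φ w = AnchoredA G φ w × (∀ φ' → AnchoredA G φ' w → βA G φ ≤ βA G φ')

-- φ is the linear arrangement induced by L(e):
-- φ(v_i) = i for i ≥ 3, {φ(v_1),φ(v_2)} = {1,2}, and the vertex at
-- position 1 has degree ≤ that at position 2.
ArrInducedBy : ∀ {n} → Graph n → Permutation′ n → Permutation′ n → Set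
ArrInducedBy {n} G φ e =
  (∀ (i : Fin n) → 2 ≤ toℕ i → φ ⟨$⟩ʳ (e ⟨$⟩ʳ i) ≡ i)
  × (∀ (i j : Fin n) → toℕ i ≡ 0 → toℕ j ≡ 1 →
       (φ ⟨$⟩ʳ (e ⟨$⟩ʳ i) ≡ i × φ ⟨$⟩ʳ (e ⟨$⟩ʳ j) ≡ j)
       ⊎ (φ ⟨$⟩ʳ (e ⟨$⟩ʳ i) ≡ j × φ ⟨$⟩ʳ (e ⟨$⟩ʳ j) ≡ i))
  × (∀ u v → toℕ (φ ⟨$⟩ʳ u) ≡ 0 → toℕ (φ ⟨$⟩ʳ v) ≡ 1 → degV G u ≤ degV G v)

-- L(e) is the linear reassembling induced by φ: it is the linear binary
-- tree with enumeration φ⁻¹(1),…,φ⁻¹(n).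
ReasInducedBy : ∀ {n} → Permutation′ n → Permutation′ n → Set
ReasInducedBy e φ = SameLBT e (flip φ)

module Submission where

-- Write L(e) for the linear reassembling with enumeration e
-- and call prefixCost e the sum of deg{v_1,…,v_k} over 2 ≤ k ≤ n.  Then
--   β(G,L(e)) = Σ_v deg{v} + prefixCost e,
--   β(G,φ)    = deg w + prefixCost φ⁻¹          whenever φ(w) = 1,
-- so for anchored objects both β-values are a constant plus a prefix cost.
-- The prefix cost only sees the prefixes of size at least two, hence it is
-- invariant under swapping the first two positions; both "induced"
-- relations produce enumerations with the same such prefixes, so e and
-- φ⁻¹ have equal prefix cost.  Moreover the anchored arrangements and the
-- anchored reassemblings realise the same prefix costs: φ gives L(φ⁻¹),
-- and L(e) gives the arrangement e⁻¹, after swapping the first two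
-- positions if w comes second.  An abstract lemma about minimisers then
-- transfers optimality in both directions.

open import Defs hiding (sym)
open import Data.Nat using (ℕ; zero; suc; _+_; _≤_; _<_; _≤?_; z≤n; s≤s; s≤s⁻¹)
open import Data.Nat.Properties
  using (+-0-commutativeMonoid; ≤-refl; ≤-reflexive; ≤-trans; ≰⇒>; n≤0⇒n≡0;
         +-cancelˡ-≤; +-monoʳ-≤; suc-injective; 1+n≰n)
open import Data.Bool using (if_then_else_; _∧_; not)
open import Data.Fin using (Fin; toℕ; _≟_) renaming (zero to fzero; suc to fsuc)
open import Data.Fin.Properties using (toℕ-injective; toℕ<n) renaming (suc-injective to fsuc-injective)
open import Data.Fin.Permutation
  using (Permutation′; _⟨$⟩ʳ_; _⟨$⟩ˡ_; flip; inverseˡ; inverseʳ; transpose; _∘ₚ_)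
import Data.Fin.Permutation.Components as Components
open import Data.Product using (∃; _×_; _,_)
open import Data.Sum using (_⊎_; inj₁; inj₂)
open import Data.Empty using (⊥-elim)
open import Function.Base using (_∘_)
open import Function.Bundles using (_⇔_; mk⇔; Equivalence; Injection; Inverse)
open import Function.Properties.Inverse using (↔⇒↣)
open import Function.Construct.Composition using (_⇔-∘_)
open import Function.Construct.Symmetry using (⇔-sym)
open import Relation.Nullary using (¬_; Dec; yes; no)
open import Relation.Nullary.Decidable using (⌊_⌋; isYes≗does; does-⇔)
open import Relation.Binary.PropositionalEquality
  using (_≡_; _≗_; refl; sym; trans; cong; cong₂; subst; subst₂)
open import Algebra.Properties.CommutativeMonoid.Sum +-0-commutativeMonoid
  using (sum; sum-cong-≗; sum-permute)

-- The recursive sum ∑ of Defs is the library's sum over vectors, so the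
-- library's congruence and reindexing lemmas apply to it.
∑≡sum : ∀ {n} (f : Fin n → ℕ) → ∑ f ≡ sum f
∑≡sum {zero}  f = refl
∑≡sum {suc n} f = cong (f fzero +_) (∑≡sum (f ∘ fsuc))

∑-cong : ∀ {n} {f g : Fin n → ℕ} → f ≗ g → ∑ f ≡ ∑ g
∑-cong {f = f} {g} f≗g = trans (∑≡sum f) (trans (sum-cong-≗ f≗g) (sym (∑≡sum g)))

∑-permute : ∀ {n} (f : Fin n → ℕ) (π : Permutation′ n) → ∑ (f ∘ (π ⟨$⟩ʳ_)) ≡ ∑ f
∑-permute f π =
  trans (∑≡sum (f ∘ (π ⟨$⟩ʳ_))) (trans (sym (sum-permute f π)) (sym (∑≡sum f)))

∑-zero : ∀ n → ∑ {n} (λ _ → 0) ≡ 0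
∑-zero zero    = refl
∑-zero (suc n) = ∑-zero n

⌊⌋-⇔ : ∀ {P Q : Set} → P ⇔ Q → (p? : Dec P) (q? : Dec Q) → ⌊ p? ⌋ ≡ ⌊ q? ⌋
⌊⌋-⇔ P⇔Q p? q? = trans (isYes≗does p?) (trans (does-⇔ P⇔Q p? q?) (sym (isYes≗does q?)))

below-two : ∀ {m} → ¬ 2 ≤ m → m ≤ 1
below-two ¬2≤m = s≤s⁻¹ (≰⇒> ¬2≤m)

permutation-injective : ∀ {n} (π : Permutation′ n) {a b : Fin n} →
                        π ⟨$⟩ʳ a ≡ π ⟨$⟩ʳ b → a ≡ b
permutation-injective π = Injection.injective (↔⇒↣ π)

inverse-of : ∀ {n} (π : Permutation′ n) {i x : Fin n} → π ⟨$⟩ʳ i ≡ x → π ⟨$⟩ˡ x ≡ i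
inverse-of π πi≡x = Inverse.inverseʳ π (sym πi≡x)

Minimal : ∀ {a} {A : Set a} → (A → Set) → (A → ℕ) → A → Set a
Minimal P f x = ∀ x' → P x' → f x ≤ f x'

minimal-shift : ∀ {a} {A : Set a} (P : A → Set) (f h : A → ℕ) (c : ℕ) →
                (∀ x → P x → f x ≡ c + h x) →
                ∀ x → P x → Minimal P f x ⇔ Minimal P h x
minimal-shift P f h c split x Px = mk⇔ to from
  where
  to : Minimal P f x → Minimal P h x
  to min x' Px' = +-cancelˡ-≤ c _ _
    (subst₂ _≤_ (split x Px) (split x' Px') (min x' Px'))
  from : Minimal P h x → Minimal P f x
  from min x' Px' = subst₂ _≤_ (sym (split x Px)) (sym (split x' Px'))
    (+-monoʳ-≤ c (min x' Px'))

minimal-transfer : ∀ {a b} {A : Set a} {B : Set b}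
                   (P : A → Set) (Q : B → Set) (f : A → ℕ) (g : B → ℕ) →
                   (∀ x → P x → ∃ λ y → Q y × g y ≤ f x) →
                   (∀ y → Q y → ∃ λ x → P x × f x ≤ g y) →
                   ∀ x y → f x ≡ g y → Minimal P f x ⇔ Minimal Q g y
minimal-transfer P Q f g P→Q Q→P x y fx≡gy = mk⇔ to from
  where
  to : Minimal P f x → Minimal Q g y
  to min y' Qy' with Q→P y' Qy'
  ... | x' , Px' , fx'≤gy' = subst (_≤ g y') fx≡gy (≤-trans (min x' Px') fx'≤gy')
  from : Minimal Q g y → Minimal P f x
  from min x' Px' with P→Q x' Px'
  ... | y' , Qy' , gy'≤fx' = subst (_≤ f x') (sym fx≡gy) (≤-trans (min y' Qy') gy'≤fx')

degS-cong : ∀ {n} (G : Graph n) {X Y : VSet n} → X ≐ Y → degS G X ≡ degS G Y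
degS-cong G X≐Y = ∑-cong λ u → ∑-cong λ v →
  cong₂ (λ a b → if a ∧ not b ∧ adj G u v then 1 else 0) (X≐Y u) (X≐Y v)

singletonCost : ∀ {n} → Graph n → ℕ
singletonCost G = ∑ λ v → degS G (singleton v)

prefixCost : ∀ {n} → Graph n → Permutation′ n → ℕ
prefixCost {n} G e =
  ∑ λ (i : Fin n) → if ⌊ 1 ≤? toℕ i ⌋ then degS G (prefix e (toℕ i)) else 0

-- The singleton clusters {v_j} of L(e) list every vertex once.
βL-split : ∀ {n} (G : Graph n) (e : Permutation′ n) →
           βL G e ≡ singletonCost G + prefixCost G e
βL-split G e = cong (_+ prefixCost G e) (∑-permute (λ v → degS G (singleton v)) e)

-- The first cluster counted by β(G,φ) is {w} when φ puts w first; the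
-- remaining ones are the prefixes of the enumeration φ⁻¹.
βA-split : ∀ {n} (G : Graph n) (φ : Permutation′ n) (w : Fin n) →
           toℕ (φ ⟨$⟩ʳ w) ≡ 0 → βA G φ ≡ degV G w + prefixCost G (flip φ)
βA-split {zero}  G φ () _
βA-split {suc n} G φ w φw≡0 =
  cong (_+ prefixCost G (flip φ)) (degS-cong G first-is-w)
  where
  first-is-w : ∀ v → ⌊ toℕ (φ ⟨$⟩ʳ v) ≤? 0 ⌋ ≡ singleton w v
  first-is-w v = ⌊⌋-⇔ (mk⇔ to from) (toℕ (φ ⟨$⟩ʳ v) ≤? 0) (v ≟ w)
    where
    to : toℕ (φ ⟨$⟩ʳ v) ≤ 0 → v ≡ w
    to φv≤0 = permutation-injective φ (toℕ-injective (trans (n≤0⇒n≡0 φv≤0) (sym φw≡0)))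
    from : v ≡ w → toℕ (φ ⟨$⟩ʳ v) ≤ 0
    from refl = ≤-reflexive φw≡0

SameLongPrefixes : ∀ {n} → Permutation′ n → Permutation′ n → Set
SameLongPrefixes {n} e e' =
  ∀ (i : Fin n) → 1 ≤ toℕ i → prefix e (toℕ i) ≐ prefix e' (toℕ i)

prefixCost-cong : ∀ {n} (G : Graph n) (e e' : Permutation′ n) →
                  SameLongPrefixes e e' → prefixCost G e ≡ prefixCost G e'
prefixCost-cong G e e' same = ∑-cong term
  where
  term : ∀ i → (if ⌊ 1 ≤? toℕ i ⌋ then degS G (prefix e (toℕ i)) else 0)
              ≡ (if ⌊ 1 ≤? toℕ i ⌋ then degS G (prefix e' (toℕ i)) else 0)
  term i with 1 ≤? toℕ i
  ... | yes 1≤i = degS-cong G (same i 1≤i)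
  ... | no  _   = refl

position : ∀ {n} → Permutation′ n → Fin n → ℕ
position e v = toℕ (e ⟨$⟩ˡ v)

AgreeBeyondTwo : ∀ {n} → Permutation′ n → Permutation′ n → Set
AgreeBeyondTwo e e' =
  ∀ v → position e v ≡ position e' v ⊎ (position e v ≤ 1 × position e' v ≤ 1)

agree⇒sameLongPrefixes : ∀ {n} (e e' : Permutation′ n) →
                         AgreeBeyondTwo e e' → SameLongPrefixes e e'
agree⇒sameLongPrefixes e e' agree i 1≤i v with agree v
... | inj₁ same      = cong (λ m → ⌊ m ≤? toℕ i ⌋) same
... | inj₂ (e≤1 , e'≤1) =
  ⌊⌋-⇔ (mk⇔ (λ _ → ≤-trans e'≤1 1≤i) (λ _ → ≤-trans e≤1 1≤i)) (_ ≤? _) (_ ≤? _)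

-- First clause of "φ is induced by L(e)": φ agrees with e from the third
-- position on.  This alone forces the first two positions to agree as
-- sets: a vertex sent by φ beyond position two is fixed there by e.
arrangement-agrees : ∀ {n} (e φ : Permutation′ n) →
                     (∀ (i : Fin n) → 2 ≤ toℕ i → φ ⟨$⟩ʳ (e ⟨$⟩ʳ i) ≡ i) →
                     AgreeBeyondTwo e (flip φ)
arrangement-agrees e φ fixed v with 2 ≤? position e v
... | yes 2≤e = inj₁ (cong toℕ (sym φv≡ev))
  where
  φv≡ev : φ ⟨$⟩ʳ v ≡ e ⟨$⟩ˡ v
  φv≡ev = trans (cong (φ ⟨$⟩ʳ_) (sym (inverseʳ e))) (fixed _ 2≤e)
... | no ¬2≤e with 2 ≤? toℕ (φ ⟨$⟩ʳ v)
...   | no ¬2≤φ = inj₂ (below-two ¬2≤e , below-two ¬2≤φ)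
...   | yes 2≤φ = ⊥-elim (¬2≤e (subst (2 ≤_) (cong toℕ (sym ev≡φv)) 2≤φ))
  where
  ev≡φv : e ⟨$⟩ˡ v ≡ φ ⟨$⟩ʳ v
  ev≡φv = inverse-of e (permutation-injective φ (fixed _ 2≤φ))

module FirstTwo {n} (i j : Fin n) (i≡0 : toℕ i ≡ 0) (j≡1 : toℕ j ≡ 1) where

  i≢j : ¬ i ≡ j
  i≢j i≡j with trans (sym i≡0) (trans (cong toℕ i≡j) j≡1)
  ... | ()

  swap-i : Components.transpose i j i ≡ j
  swap-i with i ≟ i
  ... | yes _   = refl
  ... | no  i≢i = ⊥-elim (i≢i refl)

  swap-j : Components.transpose i j j ≡ i
  swap-j with j ≟ i
  ... | yes j≡i = ⊥-elim (i≢j (sym j≡i))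
  ... | no  _ with j ≟ j
  ...   | yes _   = refl
  ...   | no  j≢j = ⊥-elim (j≢j refl)

  swap-fixes-beyond-two : ∀ k → toℕ (Components.transpose i j k) ≡ toℕ k
                                ⊎ (toℕ (Components.transpose i j k) ≤ 1 × toℕ k ≤ 1)
  swap-fixes-beyond-two k with k ≟ i
  ... | yes refl = inj₂ (≤-reflexive j≡1 , subst (_≤ 1) (sym i≡0) z≤n)
  ... | no  _ with k ≟ j
  ...   | yes refl = inj₂ (subst (_≤ 1) (sym i≡0) z≤n , ≤-reflexive j≡1)
  ...   | no  _    = inj₁ refl

size : ∀ {n} → VSet n → ℕ
size X = ∑ λ v → if X v then 1 else 0

size-cong : ∀ {n} {X Y : VSet n} → X ≐ Y → size X ≡ size Y
size-cong X≐Y = ∑-cong (λ v → cong (λ b → if b then 1 else 0) (X≐Y v))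

size-singleton : ∀ {n} (x : Fin n) → size (singleton x) ≡ 1
size-singleton {suc n} fzero    = cong suc (∑-zero n)
size-singleton {suc n} (fsuc x) = trans (∑-cong shift) (size-singleton x)
  where
  shift : ∀ (v : Fin n) → (if ⌊ fsuc v ≟ fsuc x ⌋ then 1 else 0)
                        ≡ (if ⌊ v ≟ x ⌋ then 1 else 0)
  shift v = cong (λ b → if b then 1 else 0)
                 (⌊⌋-⇔ (mk⇔ fsuc-injective (cong fsuc)) (_ ≟ _) (_ ≟ _))

positions-up-to : ∀ {n} k → k < n →
                  ∑ (λ (i : Fin n) → if ⌊ toℕ i ≤? k ⌋ then 1 else 0) ≡ suc k
positions-up-to {suc n} zero    _         = cong suc (∑-zero n)
positions-up-to {suc n} (suc k) (s≤s k<n) = cong suc (trans (∑-cong shift) (positions-up-to k k<n))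
  where
  shift : ∀ (i : Fin n) → (if ⌊ suc (toℕ i) ≤? suc k ⌋ then 1 else 0)
                        ≡ (if ⌊ toℕ i ≤? k ⌋ then 1 else 0)
  shift i = cong (λ b → if b then 1 else 0) (⌊⌋-⇔ (mk⇔ s≤s⁻¹ s≤s) (_ ≤? _) (_ ≤? _))

size-prefix : ∀ {n} (e : Permutation′ n) k → k < n → size (prefix e k) ≡ suc k
size-prefix e k k<n =
  trans (∑-permute (λ i → if ⌊ toℕ i ≤? k ⌋ then 1 else 0) (flip e)) (positions-up-to k k<n)

long-prefix-not-singleton : ∀ {n} (e : Permutation′ n) (i : Fin n) → 1 ≤ toℕ i →
                            ∀ x → ¬ prefix e (toℕ i) ≐ singleton x
long-prefix-not-singleton e i 1≤i x prefix≐singleton =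
  1+n≰n (subst (1 ≤_) (suc-injective sizes) 1≤i)
  where
  sizes : suc (toℕ i) ≡ 1
  sizes = trans (sym (size-prefix e (toℕ i) (toℕ<n i)))
                (trans (size-cong prefix≐singleton) (size-singleton x))

-- If L(e) and L(e') are the same collection, their clusters of size
-- k+1 ≥ 2 coincide: the prefix of e of that size is not a singleton, so
-- it is a prefix of e', necessarily of the same size.
sameLBT⇒sameLongPrefixes : ∀ {n} (e e' : Permutation′ n) →
                           SameLBT e e' → SameLongPrefixes e e'
sameLBT⇒sameLongPrefixes e e' same i 1≤i
  with Equivalence.to (same (prefix e (toℕ i))) (inj₂ (i , 1≤i , λ _ → refl))
... | inj₁ (x , prefix≐singleton) =
  ⊥-elim (long-prefix-not-singleton e i 1≤i (e' ⟨$⟩ʳ x) prefix≐singleton)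
... | inj₂ (j , _ , prefix≐prefix) = λ v →
  trans (prefix≐prefix v) (cong (λ m → prefix e' m v) (sym i≡j))
  where
  i≡j : toℕ i ≡ toℕ j
  i≡j = suc-injective (trans (sym (size-prefix e (toℕ i) (toℕ<n i)))
                      (trans (size-cong prefix≐prefix) (size-prefix e' (toℕ j) (toℕ<n j))))

induced⇒equal-prefixCost : ∀ {n} (G : Graph n) (e φ : Permutation′ n) →
                           ArrInducedBy G φ e ⊎ ReasInducedBy e φ →
                           prefixCost G e ≡ prefixCost G (flip φ)
induced⇒equal-prefixCost G e φ induced = prefixCost-cong G e (flip φ) (same-long-prefixes induced)
  where
  same-long-prefixes : ArrInducedBy G φ e ⊎ ReasInducedBy e φ → SameLongPrefixes e (flip φ)
  same-long-prefixes (inj₁ (fixed , _ , _)) =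
    agree⇒sameLongPrefixes e (flip φ) (arrangement-agrees e φ fixed)
  same-long-prefixes (inj₂ sameLBT) =
    sameLBT⇒sameLongPrefixes e (flip φ) sameLBT

anchoredA⇒anchoredL : ∀ {n} (G : Graph n) (φ : Permutation′ n) (w : Fin n) →
                      AnchoredA G φ w → AnchoredL G (flip φ) w
anchoredA⇒anchoredL G φ w (w' , deg≤ , φw≡0 , φw'≡1) =
  w' , deg≤ , φ ⟨$⟩ʳ w , φ ⟨$⟩ʳ w' , φw≡0 , φw'≡1 , inj₁ (inverseˡ φ , inverseˡ φ)

-- A reassembling anchored at w yields an arrangement anchored at w with
-- the same long prefixes: e⁻¹ itself if w comes first, and e⁻¹ followed
-- by the exchange of the first two positions if w comes second.
anchoredL⇒anchoredA : ∀ {n} (G : Graph n) (e : Permutation′ n) (w : Fin n) →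
                      AnchoredL G e w →
                      ∃ λ φ → AnchoredA G φ w × SameLongPrefixes (flip φ) e
anchoredL⇒anchoredA G e w (w' , deg≤ , i , j , i≡0 , j≡1 , inj₁ (ei≡w , ej≡w')) =
  flip e
  , (w' , deg≤ , trans (cong toℕ (inverse-of e ei≡w)) i≡0
              , trans (cong toℕ (inverse-of e ej≡w')) j≡1)
  , agree⇒sameLongPrefixes e e (λ _ → inj₁ refl)
anchoredL⇒anchoredA {n} G e w (w' , deg≤ , i , j , i≡0 , j≡1 , inj₂ (ei≡w' , ej≡w)) =
  φ
  , (w' , deg≤ , trans (cong toℕ φw≡i) i≡0 , trans (cong toℕ φw'≡j) j≡1)
  , agree⇒sameLongPrefixes (flip φ) e (λ v → swap-fixes-beyond-two (e ⟨$⟩ˡ v))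
  where
  open FirstTwo i j i≡0 j≡1

  φ : Permutation′ n
  φ = flip e ∘ₚ transpose i j

  φw≡i : φ ⟨$⟩ʳ w ≡ i
  φw≡i = trans (cong (Components.transpose i j) (inverse-of e ej≡w)) swap-j

  φw'≡j : φ ⟨$⟩ʳ w' ≡ j
  φw'≡j = trans (cong (Components.transpose i j) (inverse-of e ei≡w')) swap-i

lemma5p4 : ∀ {n} (G : Graph n) (w : Fin n) (e φ : Permutation′ n) →
    AnchoredL G e w → AnchoredA G φ w →
    (ArrInducedBy G φ e ⊎ ReasInducedBy e φ) →
    OptimalL G e w ⇔ OptimalA G φ w
lemma5p4 {n} G w e φ anchoredL anchoredA induced =
  mk⇔ (λ (_ , minL) → anchoredA , Equivalence.to   L⇔A minL)
      (λ (_ , minA) → anchoredL , Equivalence.from L⇔A minA)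
  where
  AncL AncA : Permutation′ n → Set
  AncL e' = AnchoredL G e' w
  AncA φ' = AnchoredA G φ' w

  costA : Permutation′ n → ℕ
  costA φ' = prefixCost G (flip φ')

  L→A : ∀ e' → AncL e' → ∃ λ φ' → AncA φ' × costA φ' ≤ prefixCost G e'
  L→A e' anchored with anchoredL⇒anchoredA G e' w anchored
  ... | φ' , anchored' , same = φ' , anchored' , ≤-reflexive (prefixCost-cong G (flip φ') e' same)

  A→L : ∀ φ' → AncA φ' → ∃ λ e' → AncL e' × prefixCost G e' ≤ costA φ'
  A→L φ' anchored = flip φ' , anchoredA⇒anchoredL G φ' w anchored , ≤-refl

  splitA : ∀ φ' → AncA φ' → βA G φ' ≡ degV G w + costA φ'
  splitA φ' (_ , _ , φ'w≡0 , _) = βA-split G φ' w φ'w≡0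

  shiftL : Minimal AncL (βL G) e ⇔ Minimal AncL (prefixCost G) e
  shiftL = minimal-shift AncL (βL G) (prefixCost G) (singletonCost G)
                         (λ e' _ → βL-split G e') e anchoredL

  transfer : Minimal AncL (prefixCost G) e ⇔ Minimal AncA costA φ
  transfer = minimal-transfer AncL AncA (prefixCost G) costA L→A A→L e φ
                              (induced⇒equal-prefixCost G e φ induced)

  shiftA : Minimal AncA (βA G) φ ⇔ Minimal AncA costA φ
  shiftA = minimal-shift AncA (βA G) costA (degV G w) splitA φ anchoredA

  L⇔A : Minimal AncL (βL G) e ⇔ Minimal AncA (βA G) φ
  L⇔A = ⇔-sym shiftA ⇔-∘ (transfer ⇔-∘ shiftL)
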